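{- Let $(C,\sqsubseteq)$ be a complete lattice, $b^*,b_*\colon C\to C$ monotone maps with $b^*$ left adjoint to $b_*$, $a\colon C\to C$ an up-closure operator and $i,f\in C$. If $b_*^j(f)\in Pre(a)$ for all $j\in\mathbb{N}$, then $a$ is $(i\sqcup b^*,f)$-complete.
   Context: $b^*$ left adjoint to $b_*$: $b^*(x)\sqsubseteq y$ iff $x\sqsubseteq b_*(y)$. An up-closure operator is a monotone $a$ with $x\sqsubseteq a(x)$, $a(a(x))\sqsubseteq a(x)$; $Pre(a)=\{x\mid a(x)\sqsubseteq x\}$. $b_*^0=\mathrm{id}$, $b_*^{j+1}=b_*\circ b_*^j$. $i\sqcup b^*$ is the map $x\mapsto i\sqcup b^*(x)$. $a$ is $(g,f)$-complete iff $a(f)\sqsubseteq f$ and ($\mu(a\circ g)\sqsubseteq f$ iff $\mu g\sqsubseteq f$), $\mu$ denoting least fixed point. -}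

module Defs where

open import Level using (Level; suc; _⊔_)
open import Data.Nat using (ℕ; zero) renaming (suc to sucℕ)
open import Data.Product using (_×_)
open import Function.Bundles using (_⇔_)
open import Relation.Binary.Bundles using (Poset)

record CompleteLattice (c ℓ₁ ℓ₂ : Level) : Set (suc (c ⊔ ℓ₁ ⊔ ℓ₂)) where
  field
    poset : Poset c ℓ₁ ℓ₂
  open Poset poset public renaming (_≤_ to _⊑_)
  field
    ⨆      : (Carrier → Set (c ⊔ ℓ₁ ⊔ ℓ₂)) → Carrier
    ⨆-ub   : (S : Carrier → Set (c ⊔ ℓ₁ ⊔ ℓ₂)) → ∀ x → S x → x ⊑ ⨆ S
    ⨆-least : (S : Carrier → Set (c ⊔ ℓ₁ ⊔ ℓ₂)) → ∀ y → (∀ x → S x → x ⊑ y) → ⨆ S ⊑ y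

  ⨅ : (Carrier → Set (c ⊔ ℓ₁ ⊔ ℓ₂)) → Carrier
  ⨅ S = ⨆ (λ y → ∀ x → S x → y ⊑ x)

  _⊔C_ : Carrier → Carrier → Carrier
  x ⊔C y = ⨆ (λ z → Level.Lift (c ⊔ ℓ₁ ⊔ ℓ₂) (z ≈ x) Data.Sum.⊎ Level.Lift (c ⊔ ℓ₁ ⊔ ℓ₂) (z ≈ y))
    where import Data.Sum

  Monotone : (Carrier → Carrier) → Set (c ⊔ ℓ₂)
  Monotone g = ∀ {x y} → x ⊑ y → g x ⊑ g y

  -- least fixed point of a map (for monotone g this is the least fixed
  -- point by Knaster–Tarski): the meet of all prefixed points
  μ : (Carrier → Carrier) → Carrier
  μ g = ⨅ (λ x → Level.Lift (c ⊔ ℓ₁ ⊔ ℓ₂) (g x ⊑ x))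

  Pre : (Carrier → Carrier) → Carrier → Set ℓ₂
  Pre a x = a x ⊑ x

  IsUpClosure : (Carrier → Carrier) → Set (c ⊔ ℓ₂)
  IsUpClosure a = Monotone a × (∀ x → x ⊑ a x) × (∀ x → a (a x) ⊑ a x)

  LeftAdjoint : (Carrier → Carrier) → (Carrier → Carrier) → Set (c ⊔ ℓ₂)
  LeftAdjoint l r = ∀ x y → (l x ⊑ y) ⇔ (x ⊑ r y)

  iter : (Carrier → Carrier) → ℕ → Carrier → Carrier
  iter g zero x = x
  iter g (sucℕ j) x = g (iter g j x)

  IsComplete : (Carrier → Carrier) → (Carrier → Carrier) → Carrier → Set ℓ₂
  IsComplete a g f = Pre a f × ((μ (λ x → a (g x)) ⊑ f) ⇔ (μ g ⊑ f))

module Submission where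

-- Proof idea.  Write g x = i ⊔ b* x and let q be the meet of the orbit
-- f, b₊ f, b₊² f, …  The condition Pre a f is the hypothesis at j = 0.
--
-- (⇒) Since a is extensive, every prefixed point of a ∘ g is a prefixed
--     point of g, so μ g ⊑ μ (a ∘ g) ⊑ f.
-- (⇐) Put m = μ g ⊑ f.  As g m ⊑ m we get i ⊑ m and b* m ⊑ m, and the
--     adjunction then pushes m below every b₊ʲ f, hence m ⊑ q.  The meet q
--     is itself b*-prefixed (again by the adjunction) and a-prefixed
--     (Pre a is closed under meets and contains the whole orbit); with
--     i ⊑ m ⊑ q this makes q a prefixed point of a ∘ g, so
--     μ (a ∘ g) ⊑ q ⊑ f.

open import Defs
open import Level using (Level; Lift; lift; lower)
open import Data.Nat using (ℕ; zero) renaming (suc to sucℕ)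
open import Data.Product using (_,_; Σ)
open import Data.Sum using (_⊎_; inj₁; inj₂)
open import Function.Bundles using (mk⇔; Equivalence)
open import Relation.Binary.PropositionalEquality using (_≡_; refl)

module LatticeFacts {c ℓ₁ ℓ₂ : Level} (L : CompleteLattice c ℓ₁ ℓ₂) where
  open CompleteLattice L

  Subset : Set (Level.suc (c Level.⊔ ℓ₁ Level.⊔ ℓ₂))
  Subset = Carrier → Set (c Level.⊔ ℓ₁ Level.⊔ ℓ₂)

  ⨅-lb : ∀ (S : Subset) x → S x → ⨅ S ⊑ x
  ⨅-lb S x Sx = ⨆-least _ x (λ z z-lb → z-lb x Sx)

  ⨅-glb : ∀ (S : Subset) y → (∀ x → S x → y ⊑ x) → y ⊑ ⨅ S
  ⨅-glb S y = ⨆-ub _ y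

  ⊔-inl : ∀ x y → x ⊑ x ⊔C y
  ⊔-inl x y = ⨆-ub _ x (inj₁ (lift Eq.refl))

  ⊔-inr : ∀ x y → y ⊑ x ⊔C y
  ⊔-inr x y = ⨆-ub _ y (inj₂ (lift Eq.refl))

  ⊔-least : ∀ {x y z} → x ⊑ z → y ⊑ z → x ⊔C y ⊑ z
  ⊔-least {x} {y} {z} x⊑z y⊑z = ⨆-least _ z bound
    where
    bound : ∀ w → Lift _ (w ≈ x) ⊎ Lift _ (w ≈ y) → w ⊑ z
    bound w (inj₁ (lift w≈x)) = trans (reflexive w≈x) x⊑z
    bound w (inj₂ (lift w≈y)) = trans (reflexive w≈y) y⊑z

  ⊔-monotoneʳ : ∀ i (h : Carrier → Carrier) → Monotone h → Monotone (λ x → i ⊔C h x)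
  ⊔-monotoneʳ i h mono {x} {y} x⊑y =
    ⊔-least (⊔-inl i (h y)) (trans (mono x⊑y) (⊔-inr i (h y)))

  μ-least : ∀ g x → g x ⊑ x → μ g ⊑ x
  μ-least g x gx⊑x = ⨅-lb _ x (lift gx⊑x)

  μ-prefixed : ∀ g → Monotone g → g (μ g) ⊑ μ g
  μ-prefixed g mono = ⨅-glb _ _ (λ x gx⊑x → trans (mono (⨅-lb _ x gx⊑x)) (lower gx⊑x))

  μ-compare : ∀ g h → (∀ x → h x ⊑ x → g x ⊑ x) → μ g ⊑ μ h
  μ-compare g h pre⇒pre =
    ⨅-glb _ _ (λ x hx⊑x → ⨅-lb _ x (lift (pre⇒pre x (lower hx⊑x))))

  Pre-⨅ : ∀ a → Monotone a → (S : Subset) → (∀ x → S x → Pre a x) → Pre a (⨅ S)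
  Pre-⨅ a mono S allPre = ⨅-glb S _ (λ x Sx → trans (mono (⨅-lb S x Sx)) (allPre x Sx))

module OrbitFacts {c ℓ₁ ℓ₂ : Level} (L : CompleteLattice c ℓ₁ ℓ₂)
                  (b* b₊ : CompleteLattice.Carrier L → CompleteLattice.Carrier L) (adj : CompleteLattice.LeftAdjoint L b* b₊)
                  where
  open CompleteLattice L hiding (refl)
  open LatticeFacts L

  Orbit : Carrier → Subset
  Orbit y x = Lift (c Level.⊔ ℓ₁ Level.⊔ ℓ₂) (Σ ℕ (λ n → x ≡ iter b₊ n y))

  ⨅Orbit : Carrier → Carrier
  ⨅Orbit y = ⨅ (Orbit y)

  ⨅Orbit-lb : ∀ y n → ⨅Orbit y ⊑ iter b₊ n y
  ⨅Orbit-lb y n = ⨅-lb (Orbit y) _ (lift (n , refl))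

  below-⨅Orbit : ∀ x y → (∀ n → x ⊑ iter b₊ n y) → x ⊑ ⨅Orbit y
  below-⨅Orbit x y below = ⨅-glb (Orbit y) x (λ { _ (lift (n , refl)) → below n })

  b*-prefixed-below-orbit : ∀ {x y} → b* x ⊑ x → x ⊑ y → ∀ n → x ⊑ iter b₊ n y
  b*-prefixed-below-orbit b*x⊑x x⊑y zero = x⊑y
  b*-prefixed-below-orbit {x} {y} b*x⊑x x⊑y (sucℕ n) =
    Equivalence.to (adj x (iter b₊ n y)) (trans b*x⊑x (b*-prefixed-below-orbit b*x⊑x x⊑y n))

  -- The orbit meet is b*-prefixed: b* q ⊑ b₊ⁿ y follows from q ⊑ b₊ⁿ⁺¹ y.
  ⨅Orbit-b*-prefixed : ∀ y → b* (⨅Orbit y) ⊑ ⨅Orbit y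
  ⨅Orbit-b*-prefixed y = below-⨅Orbit _ y
    (λ n → Equivalence.from (adj (⨅Orbit y) (iter b₊ n y)) (⨅Orbit-lb y (sucℕ n)))

  ⨅Orbit-Pre : ∀ a → Monotone a → ∀ y → (∀ n → Pre a (iter b₊ n y)) → Pre a (⨅Orbit y)
  ⨅Orbit-Pre a mono y allPre = Pre-⨅ a mono (Orbit y) (λ { _ (lift (n , refl)) → allPre n })

corollary9p11 : ∀ {c ℓ₁ ℓ₂ : Level} (L : CompleteLattice c ℓ₁ ℓ₂) →
    let open CompleteLattice L in
    (b* b₊ a : Carrier → Carrier) (i f : Carrier) →
    Monotone b* → Monotone b₊ → LeftAdjoint b* b₊ →
    IsUpClosure a →
    (∀ (j : ℕ) → Pre a (iter b₊ j f)) →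
    IsComplete a (λ x → i ⊔C b* x) f
corollary9p11 L b* b₊ a i f mono-b* _ adj (mono-a , extensive , _) orbit-Pre =
  orbit-Pre 0 , mk⇔ μag⊑f⇒μg⊑f μg⊑f⇒μag⊑f
  where
  open CompleteLattice L
  open LatticeFacts L
  open OrbitFacts L b* b₊ adj

  g : Carrier → Carrier
  g x = i ⊔C b* x

  μag⊑f⇒μg⊑f : μ (λ x → a (g x)) ⊑ f → μ g ⊑ f
  μag⊑f⇒μg⊑f = trans (μ-compare g _ (λ x agx⊑x → trans (extensive (g x)) agx⊑x))

  μg⊑f⇒μag⊑f : μ g ⊑ f → μ (λ x → a (g x)) ⊑ f
  μg⊑f⇒μag⊑f m⊑f = trans (μ-least _ q (trans (mono-a gq⊑q) aq⊑q)) (⨅Orbit-lb f 0)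
    where
    q : Carrier
    q = ⨅Orbit f
    m : Carrier
    m = μ g
    gm⊑m : g m ⊑ m
    gm⊑m = μ-prefixed g (⊔-monotoneʳ i b* mono-b*)
    m⊑q : m ⊑ q
    m⊑q = below-⨅Orbit m f
      (b*-prefixed-below-orbit (trans (⊔-inr i (b* m)) gm⊑m) m⊑f)
    gq⊑q : g q ⊑ q
    gq⊑q = ⊔-least (trans (trans (⊔-inl i (b* m)) gm⊑m) m⊑q) (⨅Orbit-b*-prefixed f)
    aq⊑q : a q ⊑ q
    aq⊑q = ⨅Orbit-Pre a mono-a f orbit-Pre
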